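{- If $s\models \phi$ and $t\models \neg \phi$ (teams in the same Kripke model, $\phi$ a formula of $\mathrm{BSML}$ or $\mathrm{BSMLI}$), then $s\cap t=\emptyset$.
   Context: $\mathrm{BSML}$: $\phi ::= p \mid \bot \mid \neg\phi \mid \phi\wedge\phi \mid \phi\vee\phi \mid \Diamond\phi \mid \mathrm{NE}$; $\mathrm{BSMLI}$ adds global disjunction $\veebar$. For a Kripke model $M=(W,R,V)$ and team $s\subseteq W$, support $s\models\phi$ and anti-support $s\models^-\phi$: $s\models p$ iff every $w\in s$ is in $V(p)$; $s\models^- p$ iff no $w\in s$ is; $s\models\bot$ iff $s=\emptyset$, $\bot$ always anti-supported; $s\models\mathrm{NE}$ iff $s\neq\emptyset$, $s\models^-\mathrm{NE}$ iff $s=\emptyset$; $s\models\neg\phi$ iff $s\models^-\phi$, $s\models^-\neg\phi$ iff $s\models\phi$; $s\models\phi\wedge\psi$ iff both; $s\models^-\phi\wedge\psi$ iff $s=t\cup u$ with $t\models^-\phi$, $u\models^-\psi$; $s\models\phi\vee\psi$ iff $s=t\cup u$ with $t\models\phi$, $u\models\psi$; $s\models^-\phi\vee\psi$ iff both anti-supported; $s\models\phi\veebar\psi$ iff $s\models\phi$ or $s\models\psi$, anti-supported iff both anti-supported; $s\models\Diamond\phi$ iff each $w\in s$ has a nonempty $t\subseteq R[w]$ with $t\models\phi$; $s\models^-\Diamond\phi$ iff $R[w]\models^-\phi$ for all $w\in s$. -}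

module Defs where

open import Data.Nat using (ℕ)
open import Data.Empty using (⊥)
open import Data.Sum using (_⊎_)
open import Data.Product using (Σ; ∃; _×_)

Prop : Set
Prop = ℕ

-- Formulas of BSMLI (BSML together with global disjunction ⩒).
-- BSML formulas are those not using ⩒; the theorem is stated for all of BSMLI,
-- which covers BSML as a special case.
data Form : Set where
  atom : Prop → Form
  falsum : Form
  ¬′_ : Form → Form
  _∧′_ : Form → Form → Form
  _∨′_ : Form → Form → Form
  ◇_ : Form → Form
  NE : Form
  _⩒_ : Form → Form → Form

record Kripke : Set₁ where
  field
    W : Set
    R : W → W → Set
    V : Prop → W → Set

Team : Set → Set₁
Team W = W → Set

module _ (M : Kripke) where
  open Kripke M

  _⊆ₜ_ : Team W → Team W → Set
  s ⊆ₜ t = ∀ w → s w → t w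

  IsUnion : Team W → Team W → Team W → Set
  IsUnion s t u = (∀ w → s w → t w ⊎ u w) × (∀ w → t w ⊎ u w → s w)

  Empty : Team W → Set
  Empty s = ∀ w → s w → ⊥

  NonEmpty : Team W → Set
  NonEmpty s = ∃ λ w → s w

  Succ : W → Team W
  Succ w v = R w v

  data _⊨_ (s : Team W) : Form → Set₁
  data _⊨⁻_ (s : Team W) : Form → Set₁

  data _⊨_ s where
    sup-atom : ∀ {p} → (∀ w → s w → V p w) → s ⊨ atom p
    sup-bot : Empty s → s ⊨ falsum
    sup-ne : NonEmpty s → s ⊨ NE
    sup-neg : ∀ {φ} → s ⊨⁻ φ → s ⊨ (¬′ φ)
    sup-and : ∀ {φ ψ} → s ⊨ φ → s ⊨ ψ → s ⊨ (φ ∧′ ψ)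
    sup-or : ∀ {φ ψ} (t u : Team W) → IsUnion s t u → t ⊨ φ → u ⊨ ψ → s ⊨ (φ ∨′ ψ)
    sup-gor₁ : ∀ {φ ψ} → s ⊨ φ → s ⊨ (φ ⩒ ψ)
    sup-gor₂ : ∀ {φ ψ} → s ⊨ ψ → s ⊨ (φ ⩒ ψ)
    sup-dia : ∀ {φ} →
      (∀ w → s w → Σ (Team W) λ t → (t ⊆ₜ Succ w) × NonEmpty t × (t ⊨ φ)) →
      s ⊨ (◇ φ)

  data _⊨⁻_ s where
    anti-atom : ∀ {p} → (∀ w → s w → V p w → ⊥) → s ⊨⁻ atom p
    anti-bot : s ⊨⁻ falsum
    anti-ne : Empty s → s ⊨⁻ NE
    anti-neg : ∀ {φ} → s ⊨ φ → s ⊨⁻ (¬′ φ)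
    anti-and : ∀ {φ ψ} (t u : Team W) → IsUnion s t u → t ⊨⁻ φ → u ⊨⁻ ψ → s ⊨⁻ (φ ∧′ ψ)
    anti-or : ∀ {φ ψ} → s ⊨⁻ φ → s ⊨⁻ ψ → s ⊨⁻ (φ ∨′ ψ)
    anti-gor : ∀ {φ ψ} → s ⊨⁻ φ → s ⊨⁻ ψ → s ⊨⁻ (φ ⩒ ψ)
    anti-dia : ∀ {φ} → (∀ w → s w → Succ w ⊨⁻ φ) → s ⊨⁻ (◇ φ)

{-# OPTIONS --safe #-}
module Submission where

open import Defs
open import Data.Empty using (⊥)
open import Data.Sum using (inj₁; inj₂)
open import Data.Product using (_,_)

module _ (M : Kripke) where
  open Kripke M

  Disjoint : Team W → Team W → Set
  Disjoint s t = ∀ w → s w → t w → ⊥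

  -- In the ◇ case the nonempty subteam of R[w] supporting φ meets R[w],
  -- which anti-supports φ because w ∈ t.
  support-antisupport-disjoint : ∀ {φ s t} → _⊨_ M s φ → _⊨⁻_ M t φ → Disjoint s t
  support-antisupport-disjoint (sup-atom V-s) (anti-atom ¬V-t) w sw tw = ¬V-t w tw (V-s w sw)
  support-antisupport-disjoint (sup-bot s-empty) anti-bot w sw tw = s-empty w sw
  support-antisupport-disjoint (sup-ne _) (anti-ne t-empty) w sw tw = t-empty w tw
  support-antisupport-disjoint (sup-neg s⊨⁻φ) (anti-neg t⊨φ) w sw tw =
    support-antisupport-disjoint t⊨φ s⊨⁻φ w tw sw
  support-antisupport-disjoint (sup-and s⊨φ s⊨ψ) (anti-and t₁ t₂ (t⊆t₁∪t₂ , _) t₁⊨⁻φ t₂⊨⁻ψ) w sw tw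
    with t⊆t₁∪t₂ w tw
  ... | inj₁ t₁w = support-antisupport-disjoint s⊨φ t₁⊨⁻φ w sw t₁w
  ... | inj₂ t₂w = support-antisupport-disjoint s⊨ψ t₂⊨⁻ψ w sw t₂w
  support-antisupport-disjoint (sup-or s₁ s₂ (s⊆s₁∪s₂ , _) s₁⊨φ s₂⊨ψ) (anti-or t⊨⁻φ t⊨⁻ψ) w sw tw
    with s⊆s₁∪s₂ w sw
  ... | inj₁ s₁w = support-antisupport-disjoint s₁⊨φ t⊨⁻φ w s₁w tw
  ... | inj₂ s₂w = support-antisupport-disjoint s₂⊨ψ t⊨⁻ψ w s₂w tw
  support-antisupport-disjoint (sup-gor₁ s⊨φ) (anti-gor t⊨⁻φ _) = support-antisupport-disjoint s⊨φ t⊨⁻φ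
  support-antisupport-disjoint (sup-gor₂ s⊨ψ) (anti-gor _ t⊨⁻ψ) = support-antisupport-disjoint s⊨ψ t⊨⁻ψ
  support-antisupport-disjoint (sup-dia witness) (anti-dia Rw⊨⁻φ) w sw tw
    with witness w sw
  ... | u , u⊆Rw , (v , uv) , u⊨φ = support-antisupport-disjoint u⊨φ (Rw⊨⁻φ w tw) v uv (u⊆Rw v uv)

proposition2p11 : (M : Kripke) (φ : Form) (s t : Team (Kripke.W M)) →
    _⊨_ M s φ → _⊨_ M t (¬′ φ) →
    ∀ w → s w → t w → ⊥
proposition2p11 M φ s t s⊨φ (sup-neg t⊨⁻φ) = support-antisupport-disjoint M s⊨φ t⊨⁻φ
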